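{- For every positive integer $m$ there is a constant $c=c(m)>0$ such that for every graph $H$ with $V(H)=[m]$ (loops allowed) for which the system \[ \sum_{j=1}^m w(ij)=1\quad\text{for every }1\le i\le m \] has no solution $w\in\mathcal W(H)$, we have $\mathfrak{Er}(H)\ge c$.
   Context: For a graph $H$ on $[m]$, $\mathcal W(H)$ is the set of symmetric functions $w:[m]^2\to[0,1]$ with $w(ij)=0$ whenever $ij\notin E(H)$ (here $ii\in E(H)$ means a loop at $i$). For $w\in\mathcal W(H)$, $\mathfrak{Er}(H,w)=\sum_{i=1}^m\big|1-\sum_{j=1}^m w(ij)\big|$, and $\mathfrak{Er}(H)=\min_{w\in\mathcal W(H)}\mathfrak{Er}(H,w)$.
   Formalization: The functions w ∈ 𝒲(H) take rational rather than real values in [0,1], and the constant c is taken in ℚ. -}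

module Defs where

open import Data.Nat using (ℕ; zero; suc)
open import Data.Fin using (Fin; zero; suc)
open import Data.Bool using (Bool; true; false)
open import Data.Rational using (ℚ; 0ℚ; 1ℚ; _+_; _-_; _≤_; ∣_∣)
open import Relation.Binary.PropositionalEquality using (_≡_)
open import Data.Product using (_×_)

record Graph (m : ℕ) : Set where
  field
    adj : Fin m → Fin m → Bool
    adj-sym : ∀ i j → adj i j ≡ adj j i
open Graph public

Σ[_] : (m : ℕ) → (Fin m → ℚ) → ℚ
Σ[ zero ] f = 0ℚ
Σ[ suc m ] f = f zero + Σ[ m ] (λ i → f (suc i))

InW : {m : ℕ} → Graph m → (Fin m → Fin m → ℚ) → Set
InW {m} H w =
  (∀ i j → w i j ≡ w j i) ×
  (∀ i j → (0ℚ ≤ w i j) × (w i j ≤ 1ℚ)) ×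
  (∀ i j → adj H i j ≡ false → w i j ≡ 0ℚ)

Er : {m : ℕ} → (Fin m → Fin m → ℚ) → ℚ
Er {m} w = Σ[ m ] (λ i → ∣ 1ℚ - Σ[ m ] (λ j → w i j) ∣)

Solves : {m : ℕ} → (Fin m → Fin m → ℚ) → Set
Solves {m} w = ∀ i → Σ[ m ] (λ j → w i j) ≡ 1ℚ

-- View H as a bipartite graph between two copies of [m]. By Hall's theorem it
-- either has a perfect matching σ, or some S ⊆ [m] has all its neighbours in a
-- set T with |T| < |S|. A perfect matching gives the solution
-- w(ij) = ½ ([σ i = j] + [σ j = i]). Otherwise let w ∈ 𝒲(H) have row sums d i.
-- Since w vanishes between S and the complement of T and is symmetric,
-- Σ_{i∈S} d i ≤ Σ_{i∈T} d i, and then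
--   𝔈𝔯(H, w) ≥ Σ_{i∈S} (1 - d i) + Σ_{i∈T} (d i - 1) ≥ |S| - |T| ≥ 1,
-- so c = 1 works for every m.
--
-- Hall's theorem, in deficiency form, goes by induction on |P|: match a
-- vertex i₀ ∈ P to a neighbour j₀ and recurse on P - i₀, Q - j₀. If that fails,
-- its violator (S, T) gives the tight pair (S, T ∪ {j₀}) of (P, Q), and the
-- problem splits into (S, T ∪ {j₀}) and (P ─ S, Q ─ (T ∪ {j₀})), both with
-- fewer left vertices.
module Submission where

open import Defs
open import Data.Nat using (ℕ)
open import Data.Fin using (Fin)
open import Data.Rational using (ℚ; 0ℚ; _≤_; _<_)
open import Data.Product using (∃; _×_)
open import Relation.Nullary using (¬_)

open import Algebra.Bundles using (CommutativeRing)
open import Data.Bool using (Bool; true; false)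
import Data.Bool as Bool
open import Data.Fin using (zero; suc; punchOut)
open import Data.Fin.Properties using (_≟_; any?; punchOut-injective; injective⇒≤)
open import Data.Fin.Subset
  using (Subset; inside; outside; _∈_; _∉_; _⊆_; ⊤; ⊥; ⁅_⁆; _∪_; _∩_; _─_; ∣_∣;
         Nonempty; Empty)
open import Data.Fin.Subset.Properties
  using (_∈?_; nonempty?; Empty-unique; ∈⊤; ⊥⊆; x∈⁅x⁆; x∈⁅y⁆⇒x≡y; x∈p∪q⁺; x∈p∪q⁻;
         x∈p∩q⁺; x∈p∩q⁻; x∈p∧x∉q⇒x∈p─q; x∈p∧x≢y⇒x∈p-y; p─q⊆p; ∣⊥∣≡0; ∣⁅x⁆∣≡1;
         p⊆q⇒∣p∣≤∣q∣; x∈p⇒∣p-x∣<∣p∣; p∩q≢∅⇒∣p─q∣<∣p∣)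
open import Data.Nat as ℕ using (zero; suc)
import Data.Nat.Properties as ℕ
open import Data.Nat.Induction using (<-wellFounded)
open import Data.Product using (_,_; proj₁; proj₂)
import Data.Rational as ℚ
open import Data.Rational using (1ℚ; ½; _+_; _-_; -_; _*_; _≤?_)
open import Data.Rational.Properties
  using (≤-refl; ≤-trans; ≤-reflexive; ≤-total; module ≤-Reasoning; +-mono-≤; +-monoˡ-≤;
         +-monoʳ-≤; *-monoʳ-≤-nonNeg; +-comm; +-identityˡ; +-identityʳ; +-inverseʳ;
         neg-distrib-+; *-identityˡ; *-zeroˡ; 0≤∣p∣; 0≤p⇒∣p∣≡p; ∣p*q∣≡∣p∣*∣q∣; ∣-∣-nonNeg;
         nonNegative⁻¹; positive⁻¹; +-*-commutativeRing)
open import Data.Rational.Solver using (module +-*-Solver)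
open import Algebra.Properties.Semiring.Sum (CommutativeRing.semiring +-*-commutativeRing)
  using (sum-syntax; sum-cong-≗; ∑-distrib-+; ∑-comm; *-distribˡ-sum)
open import Data.Sum using (_⊎_; inj₁; inj₂; [_,_]; [_,_]′)
open import Data.Vec.Base using ([]; _∷_; here; there)
open import Function using (_∘_)
open import Function.Bundles using (_⇔_; mk⇔)
open import Function.Definitions using (Injective; Surjective)
open import Induction.WellFounded using (module All)
import Relation.Binary.Construct.On as On
open import Relation.Binary.Definitions using (Decidable)
open import Relation.Binary.PropositionalEquality
  using (_≡_; refl; sym; trans; cong; cong₂; subst; subst₂; module ≡-Reasoning)
open import Relation.Nullary using (does; yes; no; contradiction; _×-dec_)
open import Relation.Nullary.Decidable using (does-⇔; dec-false; from-yes)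

private
  variable
    n : ℕ

∣p∪q∣+∣p∩q∣≡∣p∣+∣q∣ : ∀ (p q : Subset n) → ∣ p ∪ q ∣ ℕ.+ ∣ p ∩ q ∣ ≡ ∣ p ∣ ℕ.+ ∣ q ∣
∣p∪q∣+∣p∩q∣≡∣p∣+∣q∣ []            []            = refl
∣p∪q∣+∣p∩q∣≡∣p∣+∣q∣ (inside  ∷ p) (inside  ∷ q) =
  cong suc (trans (ℕ.+-suc _ _) (trans (cong suc (∣p∪q∣+∣p∩q∣≡∣p∣+∣q∣ p q)) (sym (ℕ.+-suc _ _))))
∣p∪q∣+∣p∩q∣≡∣p∣+∣q∣ (inside  ∷ p) (outside ∷ q) = cong suc (∣p∪q∣+∣p∩q∣≡∣p∣+∣q∣ p q)
∣p∪q∣+∣p∩q∣≡∣p∣+∣q∣ (outside ∷ p) (inside  ∷ q) =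
  trans (cong suc (∣p∪q∣+∣p∩q∣≡∣p∣+∣q∣ p q)) (sym (ℕ.+-suc _ _))
∣p∪q∣+∣p∩q∣≡∣p∣+∣q∣ (outside ∷ p) (outside ∷ q) = ∣p∪q∣+∣p∩q∣≡∣p∣+∣q∣ p q

∣p∪q∣≤∣p∣+∣q∣ : ∀ (p q : Subset n) → ∣ p ∪ q ∣ ℕ.≤ ∣ p ∣ ℕ.+ ∣ q ∣
∣p∪q∣≤∣p∣+∣q∣ p q = ℕ.≤-trans (ℕ.m≤m+n _ _) (ℕ.≤-reflexive (∣p∪q∣+∣p∩q∣≡∣p∣+∣q∣ p q))

Empty⇒∣p∣≡0 : ∀ {p : Subset n} → Empty p → ∣ p ∣ ≡ 0
Empty⇒∣p∣≡0 {n} p-empty = trans (cong ∣_∣ (Empty-unique p-empty)) (∣⊥∣≡0 n)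

Empty[p∩q]⇒∣p∪q∣≡∣p∣+∣q∣ : ∀ (p q : Subset n) → Empty (p ∩ q) → ∣ p ∪ q ∣ ≡ ∣ p ∣ ℕ.+ ∣ q ∣
Empty[p∩q]⇒∣p∪q∣≡∣p∣+∣q∣ p q disjoint = begin
  ∣ p ∪ q ∣                ≡⟨ ℕ.+-identityʳ _ ⟨
  ∣ p ∪ q ∣ ℕ.+ 0          ≡⟨ cong (∣ p ∪ q ∣ ℕ.+_) (Empty⇒∣p∣≡0 disjoint) ⟨
  ∣ p ∪ q ∣ ℕ.+ ∣ p ∩ q ∣  ≡⟨ ∣p∪q∣+∣p∩q∣≡∣p∣+∣q∣ p q ⟩
  ∣ p ∣ ℕ.+ ∣ q ∣          ∎
  where open ≡-Reasoning

∣p∣>0⇒Nonempty : ∀ {p : Subset n} → 0 ℕ.< ∣ p ∣ → Nonempty p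
∣p∣>0⇒Nonempty {p = p} 0<∣p∣ with nonempty? p
... | yes p-nonempty = p-nonempty
... | no  p-empty    = contradiction (subst (0 ℕ.<_) (Empty⇒∣p∣≡0 p-empty) 0<∣p∣) ℕ.n≮0

x∈p─q⇒x∉q : ∀ {x : Fin n} {p q : Subset n} → x ∈ p ─ q → x ∉ q
x∈p─q⇒x∉q {p = _ ∷ _}      {inside  ∷ _} (there x∈p─q) (there x∈q) = x∈p─q⇒x∉q x∈p─q x∈q
x∈p─q⇒x∉q {p = _ ∷ _}      {outside ∷ _} (there x∈p─q) (there x∈q) = x∈p─q⇒x∉q x∈p─q x∈q
x∈p─q⇒x∉q {p = inside ∷ _} {outside ∷ _} here ()

x∈p⇒⁅x⁆⊆p : ∀ {x : Fin n} {p : Subset n} → x ∈ p → ⁅ x ⁆ ⊆ p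
x∈p⇒⁅x⁆⊆p {x = x} {p} x∈p y∈⁅x⁆ = subst (_∈ p) (sym (x∈⁅y⁆⇒x≡y x y∈⁅x⁆)) x∈p

module Hall {m n : ℕ} (R : Fin m → Fin n → Set) where

  record Matching (P : Subset m) (Q : Subset n) : Set where
    field
      match      : ∀ {i} → i ∈ P → Fin n
      match-∈    : ∀ {i} (i∈P : i ∈ P) → match i∈P ∈ Q
      match-edge : ∀ {i} (i∈P : i ∈ P) → R i (match i∈P)
      match-inj  : ∀ {i i′} (i∈P : i ∈ P) (i′∈P : i′ ∈ P) → match i∈P ≡ match i′∈P → i ≡ i′

  record Closed (P : Subset m) (Q : Subset n) (S : Subset m) (T : Subset n) : Set where
    field
      S⊆P    : S ⊆ P
      T⊆Q    : T ⊆ Q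
      N[S]⊆T : ∀ {i j} → i ∈ S → j ∈ Q → R i j → j ∈ T

  record Violator (P : Subset m) (Q : Subset n) : Set where
    field
      S       : Subset m
      T       : Subset n
      closed  : Closed P Q S T
      ∣T∣<∣S∣ : ∣ T ∣ ℕ.< ∣ S ∣

  MatchingOrViolator : Subset m → Subset n → Set
  MatchingOrViolator P Q = Matching P Q ⊎ Violator P Q

  MatchingOrViolatorBelow : Subset m → Set
  MatchingOrViolatorBelow P = ∀ {P′} → ∣ P′ ∣ ℕ.< ∣ P ∣ → ∀ Q′ → MatchingOrViolator P′ Q′

  empty-matching : ∀ {P Q} → Empty P → Matching P Q
  empty-matching P-empty = record
    { match      = λ i∈P → contradiction (_ , i∈P) P-empty
    ; match-∈    = λ i∈P → contradiction (_ , i∈P) P-empty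
    ; match-edge = λ i∈P → contradiction (_ , i∈P) P-empty
    ; match-inj  = λ i∈P _ _ → contradiction (_ , i∈P) P-empty
    }

  singleton-matching : ∀ {i₀ j₀} → R i₀ j₀ → Matching ⁅ i₀ ⁆ ⁅ j₀ ⁆
  singleton-matching {i₀} {j₀} i₀Rj₀ = record
    { match      = λ _ → j₀
    ; match-∈    = λ _ → x∈⁅x⁆ j₀
    ; match-edge = λ i∈⁅i₀⁆ → subst (λ i → R i j₀) (sym (x∈⁅y⁆⇒x≡y i₀ i∈⁅i₀⁆)) i₀Rj₀
    ; match-inj  = λ i∈⁅i₀⁆ i′∈⁅i₀⁆ _ →
        trans (x∈⁅y⁆⇒x≡y i₀ i∈⁅i₀⁆) (sym (x∈⁅y⁆⇒x≡y i₀ i′∈⁅i₀⁆))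
    }

  combine-matchings : ∀ {P Q S T} → T ⊆ Q →
                      Matching S T → Matching (P ─ S) (Q ─ T) → Matching P Q
  combine-matchings {P} {Q} {S} {T} T⊆Q M₁ M₂ = record
    { match = match ; match-∈ = match-∈ ; match-edge = match-edge ; match-inj = match-inj }
    where
    module M₁ = Matching M₁
    module M₂ = Matching M₂

    match : ∀ {i} → i ∈ P → Fin n
    match {i} i∈P with i ∈? S
    ... | yes i∈S = M₁.match i∈S
    ... | no  i∉S = M₂.match (x∈p∧x∉q⇒x∈p─q i∈P i∉S)

    match-∈ : ∀ {i} (i∈P : i ∈ P) → match i∈P ∈ Q
    match-∈ {i} i∈P with i ∈? S
    ... | yes i∈S = T⊆Q (M₁.match-∈ i∈S)
    ... | no  _   = p─q⊆p Q T (M₂.match-∈ _)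

    match-edge : ∀ {i} (i∈P : i ∈ P) → R i (match i∈P)
    match-edge {i} i∈P with i ∈? S
    ... | yes i∈S = M₁.match-edge i∈S
    ... | no  _   = M₂.match-edge _

    match-inj : ∀ {i i′} (i∈P : i ∈ P) (i′∈P : i′ ∈ P) → match i∈P ≡ match i′∈P → i ≡ i′
    match-inj {i} {i′} i∈P i′∈P with i ∈? S | i′ ∈? S
    ... | yes i∈S | yes i′∈S = M₁.match-inj i∈S i′∈S
    ... | no  _   | no  _    = M₂.match-inj _ _
    ... | yes i∈S | no  _    = λ eq →
      contradiction (subst (_∈ T) eq (M₁.match-∈ i∈S)) (x∈p─q⇒x∉q (M₂.match-∈ _))
    ... | no  _   | yes i′∈S = λ eq →
      contradiction (subst (_∈ T) (sym eq) (M₁.match-∈ i′∈S)) (x∈p─q⇒x∉q (M₂.match-∈ _))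

  isolated-violator : ∀ {P Q i₀} → i₀ ∈ P → (∀ {j} → j ∈ Q → ¬ R i₀ j) → Violator P Q
  isolated-violator {P} {Q} {i₀} i₀∈P isolated = record
    { S = ⁅ i₀ ⁆ ; T = ⊥ ; closed = closed ; ∣T∣<∣S∣ = ∣⊥∣<∣⁅i₀⁆∣ }
    where
    closed : Closed P Q ⁅ i₀ ⁆ ⊥
    closed = record
      { S⊆P    = x∈p⇒⁅x⁆⊆p i₀∈P
      ; T⊆Q    = ⊥⊆
      ; N[S]⊆T = λ i∈⁅i₀⁆ j∈Q iRj →
          contradiction (subst (λ i → R i _) (x∈⁅y⁆⇒x≡y i₀ i∈⁅i₀⁆) iRj) (isolated j∈Q)
      }

    ∣⊥∣<∣⁅i₀⁆∣ : ∣ ⊥ {n = n} ∣ ℕ.< ∣ ⁅ i₀ ⁆ ∣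
    ∣⊥∣<∣⁅i₀⁆∣ rewrite ∣⊥∣≡0 n | ∣⁅x⁆∣≡1 i₀ = ℕ.s≤s ℕ.z≤n

  Closed-trans : ∀ {P Q S T S′ T′} → Closed P Q S T → Closed S T S′ T′ → Closed P Q S′ T′
  Closed-trans c c′ = record
    { S⊆P    = C.S⊆P ∘ C′.S⊆P
    ; T⊆Q    = C.T⊆Q ∘ C′.T⊆Q
    ; N[S]⊆T = λ i∈S′ j∈Q iRj → C′.N[S]⊆T i∈S′ (C.N[S]⊆T (C′.S⊆P i∈S′) j∈Q iRj) iRj
    }
    where
    module C  = Closed c
    module C′ = Closed c′

  Closed-∪ : ∀ {P Q S T S′ T′} →
             Closed P Q S T → Closed (P ─ S) (Q ─ T) S′ T′ → Closed P Q (S′ ∪ S) (T′ ∪ T)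
  Closed-∪ {P} {Q} {S} {T} {S′} {T′} c c′ = record
    { S⊆P    = λ i∈S′∪S → [ p─q⊆p P S ∘ C′.S⊆P , C.S⊆P ] (x∈p∪q⁻ S′ S i∈S′∪S)
    ; T⊆Q    = λ j∈T′∪T → [ p─q⊆p Q T ∘ C′.T⊆Q , C.T⊆Q ] (x∈p∪q⁻ T′ T j∈T′∪T)
    ; N[S]⊆T = N[S′∪S]⊆T′∪T
    }
    where
    module C  = Closed c
    module C′ = Closed c′

    N[S′∪S]⊆T′∪T : ∀ {i j} → i ∈ S′ ∪ S → j ∈ Q → R i j → j ∈ T′ ∪ T
    N[S′∪S]⊆T′∪T {j = j} i∈S′∪S j∈Q iRj with x∈p∪q⁻ S′ S i∈S′∪S | j ∈? T
    ... | _         | yes j∈T = x∈p∪q⁺ (inj₂ j∈T)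
    ... | inj₂ i∈S  | no  j∉T = contradiction (C.N[S]⊆T i∈S j∈Q iRj) j∉T
    ... | inj₁ i∈S′ | no  j∉T = x∈p∪q⁺ (inj₁ (C′.N[S]⊆T i∈S′ (x∈p∧x∉q⇒x∈p─q j∈Q j∉T) iRj))

  Closed-insert : ∀ {P Q S T i₀ j₀} → j₀ ∈ Q →
                  Closed (P ─ ⁅ i₀ ⁆) (Q ─ ⁅ j₀ ⁆) S T → Closed P Q S (T ∪ ⁅ j₀ ⁆)
  Closed-insert {P} {Q} {S} {T} {i₀} {j₀} j₀∈Q c = record
    { S⊆P    = p─q⊆p P ⁅ i₀ ⁆ ∘ S⊆P
    ; T⊆Q    = λ j∈T∪⁅j₀⁆ →
        [ p─q⊆p Q ⁅ j₀ ⁆ ∘ T⊆Q , x∈p⇒⁅x⁆⊆p j₀∈Q ] (x∈p∪q⁻ T ⁅ j₀ ⁆ j∈T∪⁅j₀⁆)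
    ; N[S]⊆T = N[S]⊆T∪⁅j₀⁆
    }
    where
    open Closed c

    N[S]⊆T∪⁅j₀⁆ : ∀ {i j} → i ∈ S → j ∈ Q → R i j → j ∈ T ∪ ⁅ j₀ ⁆
    N[S]⊆T∪⁅j₀⁆ {j = j} i∈S j∈Q iRj with j ≟ j₀
    ... | yes refl = x∈p∪q⁺ (inj₂ (x∈⁅x⁆ j₀))
    ... | no  j≢j₀ = x∈p∪q⁺ (inj₁ (N[S]⊆T i∈S (x∈p∧x≢y⇒x∈p-y j∈Q j≢j₀) iRj))

  restrict-violator : ∀ {P Q S T} → Closed P Q S T → Violator S T → Violator P Q
  restrict-violator c V = record { closed = Closed-trans c closed ; ∣T∣<∣S∣ = ∣T∣<∣S∣ }
    where open Violator V

  merge-violator : ∀ {P Q S T} → Closed P Q S T → ∣ T ∣ ℕ.≤ ∣ S ∣ →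
                   Violator (P ─ S) (Q ─ T) → Violator P Q
  merge-violator {S = S₀} {T₀} c ∣T₀∣≤∣S₀∣ V = record
    { closed = Closed-∪ c closed ; ∣T∣<∣S∣ = ∣T∪T₀∣<∣S∪S₀∣ }
    where
    open Violator V
    open ℕ.≤-Reasoning

    disjoint : Empty (S ∩ S₀)
    disjoint (_ , x∈S∩S₀) =
      let x∈S , x∈S₀ = x∈p∩q⁻ S S₀ x∈S∩S₀ in x∈p─q⇒x∉q (Closed.S⊆P closed x∈S) x∈S₀

    ∣T∪T₀∣<∣S∪S₀∣ : ∣ T ∪ T₀ ∣ ℕ.< ∣ S ∪ S₀ ∣
    ∣T∪T₀∣<∣S∪S₀∣ = begin-strict
      ∣ T ∪ T₀ ∣        ≤⟨ ∣p∪q∣≤∣p∣+∣q∣ T T₀ ⟩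
      ∣ T ∣ ℕ.+ ∣ T₀ ∣  <⟨ ℕ.+-mono-<-≤ ∣T∣<∣S∣ ∣T₀∣≤∣S₀∣ ⟩
      ∣ S ∣ ℕ.+ ∣ S₀ ∣  ≡⟨ Empty[p∩q]⇒∣p∪q∣≡∣p∣+∣q∣ S S₀ disjoint ⟨
      ∣ S ∪ S₀ ∣        ∎

  split-at-tight : ∀ {P Q S T} → Closed P Q S T → ∣ T ∣ ℕ.≤ ∣ S ∣ →
                   MatchingOrViolator S T → MatchingOrViolator (P ─ S) (Q ─ T) →
                   MatchingOrViolator P Q
  split-at-tight c _       (inj₂ V)  _         = inj₂ (restrict-violator c V)
  split-at-tight c ∣T∣≤∣S∣ (inj₁ _)  (inj₂ V)  = inj₂ (merge-violator c ∣T∣≤∣S∣ V)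
  split-at-tight c _       (inj₁ M₁) (inj₁ M₂) =
    inj₁ (combine-matchings (Closed.T⊆Q c) M₁ M₂)

  split-at-violator : ∀ {P Q i₀ j₀} → MatchingOrViolatorBelow P →
                      i₀ ∈ P → j₀ ∈ Q → Violator (P ─ ⁅ i₀ ⁆) (Q ─ ⁅ j₀ ⁆) →
                      MatchingOrViolator P Q
  split-at-violator {P} {Q} {i₀} {j₀} ih i₀∈P j₀∈Q V =
    split-at-tight c ∣T⁺∣≤∣S∣ (ih ∣S∣<∣P∣ T⁺) (ih ∣P─S∣<∣P∣ (Q ─ T⁺))
    where
    open Violator V
    open ℕ.≤-Reasoning

    T⁺ : Subset n
    T⁺ = T ∪ ⁅ j₀ ⁆

    c : Closed P Q S T⁺
    c = Closed-insert j₀∈Q closed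

    ∣T⁺∣≤∣S∣ : ∣ T⁺ ∣ ℕ.≤ ∣ S ∣
    ∣T⁺∣≤∣S∣ = begin
      ∣ T⁺ ∣                ≤⟨ ∣p∪q∣≤∣p∣+∣q∣ T ⁅ j₀ ⁆ ⟩
      ∣ T ∣ ℕ.+ ∣ ⁅ j₀ ⁆ ∣  ≡⟨ cong (∣ T ∣ ℕ.+_) (∣⁅x⁆∣≡1 j₀) ⟩
      ∣ T ∣ ℕ.+ 1           ≡⟨ ℕ.+-comm ∣ T ∣ 1 ⟩
      suc ∣ T ∣             ≤⟨ ∣T∣<∣S∣ ⟩
      ∣ S ∣                 ∎

    ∣S∣<∣P∣ : ∣ S ∣ ℕ.< ∣ P ∣
    ∣S∣<∣P∣ = ℕ.≤-<-trans (p⊆q⇒∣p∣≤∣q∣ (Closed.S⊆P closed)) (x∈p⇒∣p-x∣<∣p∣ i₀∈P)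

    ∣P─S∣<∣P∣ : ∣ P ─ S ∣ ℕ.< ∣ P ∣
    ∣P─S∣<∣P∣ with i , i∈S ← ∣p∣>0⇒Nonempty (ℕ.≤-<-trans ℕ.z≤n ∣T∣<∣S∣) =
      p∩q≢∅⇒∣p─q∣<∣p∣ P S (i , x∈p∩q⁺ (Closed.S⊆P c i∈S , i∈S))

  module _ (R? : Decidable R) where

    hall-step : ∀ {P} → MatchingOrViolatorBelow P → ∀ Q → MatchingOrViolator P Q
    hall-step {P} ih Q with nonempty? P
    ... | no P-empty = inj₁ (empty-matching P-empty)
    ... | yes (i₀ , i₀∈P) with any? (λ j → j ∈? Q ×-dec R? i₀ j)
    ...   | no isolated = inj₂ (isolated-violator i₀∈P (λ j∈Q i₀Rj → isolated (_ , j∈Q , i₀Rj)))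
    ...   | yes (j₀ , j₀∈Q , i₀Rj₀) with ih (x∈p⇒∣p-x∣<∣p∣ i₀∈P) (Q ─ ⁅ j₀ ⁆)
    ...     | inj₁ M = inj₁ (combine-matchings (x∈p⇒⁅x⁆⊆p j₀∈Q) (singleton-matching i₀Rj₀) M)
    ...     | inj₂ V = split-at-violator ih i₀∈P j₀∈Q V

    hall : ∀ P Q → MatchingOrViolator P Q
    hall = All.wfRec (On.wellFounded ∣_∣ <-wellFounded) _
             (λ P → ∀ Q → MatchingOrViolator P Q) (λ _ → hall-step)

injective⇒surjective : ∀ {f : Fin n → Fin n} → Injective _≡_ _≡_ f → Surjective _≡_ _≡_ f
injective⇒surjective {suc n} {f} f-injective i with any? (λ j → f j ≟ i)
... | yes (j , fj≡i) = j , λ { refl → fj≡i }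
... | no  i∉image    = contradiction (injective⇒≤ g-injective) ℕ.1+n≰n
  where
  g : Fin (suc n) → Fin n
  g j = punchOut {i = i} {j = f j} (λ i≡fj → i∉image (j , sym i≡fj))

  g-injective : Injective _≡_ _≡_ g
  g-injective gj≡gk = f-injective (punchOut-injective {i = i} _ _ gj≡gk)

Σ≡∑ : ∀ n (f : Fin n → ℚ) → Σ[ n ] f ≡ ∑[ i < n ] f i
Σ≡∑ zero    f = refl
Σ≡∑ (suc n) f = cong (f zero +_) (Σ≡∑ n (λ i → f (suc i)))

∑-mono-≤ : ∀ {f g : Fin n → ℚ} → (∀ i → f i ≤ g i) → ∑[ i < n ] f i ≤ ∑[ i < n ] g i
∑-mono-≤ {zero}  f≤g = ≤-refl
∑-mono-≤ {suc n} f≤g = +-mono-≤ (f≤g zero) (∑-mono-≤ (λ i → f≤g (suc i)))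

∑-neg : ∀ (f : Fin n → ℚ) → ∑[ i < n ] (- f i) ≡ - ∑[ i < n ] f i
∑-neg {zero}  f = refl
∑-neg {suc n} f =
  trans (cong (- f zero +_) (∑-neg (λ i → f (suc i)))) (sym (neg-distrib-+ (f zero) _))

∑-distrib-─ : ∀ (f g : Fin n → ℚ) → ∑[ i < n ] (f i - g i) ≡ ∑[ i < n ] f i - ∑[ i < n ] g i
∑-distrib-─ f g = trans (∑-distrib-+ f (λ i → - g i)) (cong (∑[ i < _ ] f i +_) (∑-neg g))

χ : Bool → ℚ
χ true  = 1ℚ
χ false = 0ℚ

𝟙 : Subset n → Fin n → ℚ
𝟙 p i = χ (does (i ∈? p))

𝟙-cong : ∀ {x y : Fin n} {p q : Subset n} → x ∈ p ⇔ y ∈ q → 𝟙 p x ≡ 𝟙 q y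
𝟙-cong {x = x} {y} {p} {q} x∈p⇔y∈q = cong χ (does-⇔ x∈p⇔y∈q (x ∈? p) (y ∈? q))

𝟙-∉ : ∀ {x : Fin n} {p : Subset n} → x ∉ p → 𝟙 p x ≡ 0ℚ
𝟙-∉ {x = x} {p} x∉p = cong χ (dec-false (x ∈? p) x∉p)

fromℕ : ℕ → ℚ
fromℕ zero    = 0ℚ
fromℕ (suc n) = 1ℚ + fromℕ n

∑-𝟙 : ∀ (p : Subset n) → ∑[ i < n ] 𝟙 p i ≡ fromℕ ∣ p ∣
∑-𝟙 []            = refl
∑-𝟙 (inside  ∷ p) = cong (1ℚ +_) (∑-𝟙 p)
∑-𝟙 (outside ∷ p) = trans (+-identityˡ _) (∑-𝟙 p)

∑-𝟙⁅⁆ : ∀ (i : Fin n) → ∑[ j < n ] 𝟙 ⁅ i ⁆ j ≡ 1ℚ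
∑-𝟙⁅⁆ i = trans (∑-𝟙 ⁅ i ⁆) (cong fromℕ (∣⁅x⁆∣≡1 i))

0≤fromℕ : ∀ n → 0ℚ ≤ fromℕ n
0≤fromℕ zero    = ≤-refl
0≤fromℕ (suc n) = +-mono-≤ (nonNegative⁻¹ 1ℚ) (0≤fromℕ n)

fromℕ-mono-≤ : ∀ {m n} → m ℕ.≤ n → fromℕ m ≤ fromℕ n
fromℕ-mono-≤ {n = n} ℕ.z≤n       = 0≤fromℕ n
fromℕ-mono-≤         (ℕ.s≤s m≤n) = +-monoʳ-≤ 1ℚ (fromℕ-mono-≤ m≤n)

m<n⇒1≤fromℕn-fromℕm : ∀ {m n} → m ℕ.< n → 1ℚ ≤ fromℕ n - fromℕ m
m<n⇒1≤fromℕn-fromℕm {m} {n} m<n = begin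
  1ℚ                       ≡⟨ solve 1 (λ x → con 1ℚ := con 1ℚ :+ x :- x) refl (fromℕ m) ⟩
  1ℚ + fromℕ m - fromℕ m   ≤⟨ +-monoˡ-≤ (- fromℕ m) (fromℕ-mono-≤ m<n) ⟩
  fromℕ n - fromℕ m        ∎
  where
  open ≤-Reasoning
  open +-*-Solver

p≤q⇒0≤q-p : ∀ {p q} → p ≤ q → 0ℚ ≤ q - p
p≤q⇒0≤q-p {p} {q} p≤q = subst (_≤ q - p) (+-inverseʳ p) (+-monoˡ-≤ (- p) p≤q)

0≤q⇒p≤p+q : ∀ p {q} → 0ℚ ≤ q → p ≤ p + q
0≤q⇒p≤p+q p 0≤q = subst (_≤ p + _) (+-identityʳ p) (+-monoʳ-≤ p 0≤q)

p≤∣p∣ : ∀ p → p ≤ ℚ.∣ p ∣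
p≤∣p∣ p with ≤-total 0ℚ p
... | inj₁ 0≤p = ≤-reflexive (sym (0≤p⇒∣p∣≡p 0≤p))
... | inj₂ p≤0 = ≤-trans p≤0 (0≤∣p∣ p)

∣c∣≤1⇒c*p≤∣p∣ : ∀ {c} p → ℚ.∣ c ∣ ≤ 1ℚ → c * p ≤ ℚ.∣ p ∣
∣c∣≤1⇒c*p≤∣p∣ {c} p ∣c∣≤1 = begin
  c * p                ≤⟨ p≤∣p∣ (c * p) ⟩
  ℚ.∣ c * p ∣          ≡⟨ ∣p*q∣≡∣p∣*∣q∣ c p ⟩
  ℚ.∣ c ∣ * ℚ.∣ p ∣    ≤⟨ *-monoʳ-≤-nonNeg ℚ.∣ p ∣ {{∣-∣-nonNeg p}} ∣c∣≤1 ⟩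
  1ℚ * ℚ.∣ p ∣         ≡⟨ *-identityˡ _ ⟩
  ℚ.∣ p ∣              ∎
  where open ≤-Reasoning

∣χa-χb∣≤1 : ∀ a b → ℚ.∣ χ a - χ b ∣ ≤ 1ℚ
∣χa-χb∣≤1 true  true  = nonNegative⁻¹ 1ℚ
∣χa-χb∣≤1 true  false = ≤-refl
∣χa-χb∣≤1 false true  = ≤-refl
∣χa-χb∣≤1 false false = nonNegative⁻¹ 1ℚ

½[χa+χb]∈[0,1] : ∀ a b → 0ℚ ≤ ½ * (χ a + χ b) × ½ * (χ a + χ b) ≤ 1ℚ
½[χa+χb]∈[0,1] true  true  = nonNegative⁻¹ 1ℚ , ≤-refl
½[χa+χb]∈[0,1] true  false = nonNegative⁻¹ ½ , from-yes (½ ≤? 1ℚ)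
½[χa+χb]∈[0,1] false true  = nonNegative⁻¹ ½ , from-yes (½ ≤? 1ℚ)
½[χa+χb]∈[0,1] false false = ≤-refl , nonNegative⁻¹ 1ℚ

degree : (Fin n → Fin n → ℚ) → Fin n → ℚ
degree {n} w i = ∑[ j < n ] w i j

module _ {m} {w : Fin m → Fin m → ℚ} {S T : Subset m}
         (w-sym : ∀ i j → w i j ≡ w j i) (w≥0 : ∀ i j → 0ℚ ≤ w i j)
         (w-vanishes : ∀ {i j} → i ∈ S → j ∉ T → w i j ≡ 0ℚ) where

  𝟙*w-mono : ∀ i j → 𝟙 S i * w i j ≤ 𝟙 T j * w i j
  𝟙*w-mono i j with i ∈? S | j ∈? T
  ... | yes _   | yes _   = ≤-refl
  ... | no  _   | no  _   = ≤-refl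
  ... | yes i∈S | no  j∉T rewrite w-vanishes i∈S j∉T = ≤-refl
  ... | no  _   | yes _   =
    subst₂ _≤_ (sym (*-zeroˡ (w i j))) (sym (*-identityˡ (w i j))) (w≥0 i j)

  ∑-𝟙*degree-mono : ∑[ i < m ] (𝟙 S i * degree w i) ≤ ∑[ i < m ] (𝟙 T i * degree w i)
  ∑-𝟙*degree-mono = begin
    ∑[ i < m ] (𝟙 S i * degree w i)
      ≡⟨ sum-cong-≗ (λ i → *-distribˡ-sum (𝟙 S i) (w i)) ⟩
    ∑[ i < m ] ∑[ j < m ] (𝟙 S i * w i j)
      ≤⟨ ∑-mono-≤ (λ i → ∑-mono-≤ (𝟙*w-mono i)) ⟩
    ∑[ i < m ] ∑[ j < m ] (𝟙 T j * w i j)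
      ≡⟨ ∑-comm (λ i j → 𝟙 T j * w i j) ⟩
    ∑[ j < m ] ∑[ i < m ] (𝟙 T j * w i j)
      ≡⟨ sum-cong-≗ (λ j → sum-cong-≗ (λ i → cong (𝟙 T j *_) (w-sym i j))) ⟩
    ∑[ j < m ] ∑[ i < m ] (𝟙 T j * w j i)
      ≡⟨ sum-cong-≗ (λ j → *-distribˡ-sum (𝟙 T j) (w j)) ⟨
    ∑[ j < m ] (𝟙 T j * degree w j)
      ∎
    where open ≤-Reasoning

  deficiency-bound : fromℕ (∣ S ∣) - fromℕ (∣ T ∣) ≤ ∑[ i < m ] ℚ.∣ 1ℚ - degree w i ∣
  deficiency-bound = begin
    fromℕ (∣ S ∣) - fromℕ (∣ T ∣)
      ≡⟨ cong₂ _-_ (∑-𝟙 S) (∑-𝟙 T) ⟨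
    ∑[ i < m ] 𝟙 S i - ∑[ i < m ] 𝟙 T i
      ≡⟨ ∑-distrib-─ (𝟙 S) (𝟙 T) ⟨
    ∑[ i < m ] c i
      ≤⟨ 0≤q⇒p≤p+q _ 0≤∑[𝟙T*d-𝟙S*d] ⟩
    ∑[ i < m ] c i + ∑[ i < m ] (𝟙 T i * d i - 𝟙 S i * d i)
      ≡⟨ ∑-distrib-+ c _ ⟨
    ∑[ i < m ] (c i + (𝟙 T i * d i - 𝟙 S i * d i))
      ≡⟨ sum-cong-≗ (λ i → rearrange (𝟙 S i) (𝟙 T i) (d i)) ⟩
    ∑[ i < m ] (c i * (1ℚ - d i))
      ≤⟨ ∑-mono-≤ (λ i → ∣c∣≤1⇒c*p≤∣p∣ (1ℚ - d i) (∣c∣≤1 i)) ⟩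
    ∑[ i < m ] ℚ.∣ 1ℚ - d i ∣
      ∎
    where
    open ≤-Reasoning

    c d : Fin m → ℚ
    c i = 𝟙 S i - 𝟙 T i
    d   = degree w

    ∣c∣≤1 : ∀ i → ℚ.∣ c i ∣ ≤ 1ℚ
    ∣c∣≤1 i = ∣χa-χb∣≤1 (does (i ∈? S)) (does (i ∈? T))

    0≤∑[𝟙T*d-𝟙S*d] : 0ℚ ≤ ∑[ i < m ] (𝟙 T i * d i - 𝟙 S i * d i)
    0≤∑[𝟙T*d-𝟙S*d] = subst (0ℚ ≤_) (sym (∑-distrib-─ (λ i → 𝟙 T i * d i) (λ i → 𝟙 S i * d i)))
                                   (p≤q⇒0≤q-p ∑-𝟙*degree-mono)

    rearrange : ∀ a b x → (a - b) + (b * x - a * x) ≡ (a - b) * (1ℚ - x)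
    rearrange = solve 3 (λ a b x → (a :- b) :+ (b :* x :- a :* x) := (a :- b) :* (con 1ℚ :- x)) refl
      where open +-*-Solver

matching-weight : (Fin n → Fin n) → Fin n → Fin n → ℚ
matching-weight σ i j = ½ * (𝟙 ⁅ σ i ⁆ j + 𝟙 ⁅ σ j ⁆ i)

degree-matching-weight : ∀ {σ : Fin n → Fin n} → Injective _≡_ _≡_ σ →
                         ∀ i → degree (matching-weight σ) i ≡ 1ℚ
degree-matching-weight {n} {σ} σ-injective i = begin
  ∑[ j < n ] (½ * (𝟙 ⁅ σ i ⁆ j + 𝟙 ⁅ σ j ⁆ i))
    ≡⟨ *-distribˡ-sum ½ (λ j → 𝟙 ⁅ σ i ⁆ j + 𝟙 ⁅ σ j ⁆ i) ⟨
  ½ * ∑[ j < n ] (𝟙 ⁅ σ i ⁆ j + 𝟙 ⁅ σ j ⁆ i)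
    ≡⟨ cong (½ *_) (∑-distrib-+ (𝟙 ⁅ σ i ⁆) _) ⟩
  ½ * (∑[ j < n ] 𝟙 ⁅ σ i ⁆ j + ∑[ j < n ] 𝟙 ⁅ σ j ⁆ i)
    ≡⟨ cong (λ x → ½ * (∑[ j < n ] 𝟙 ⁅ σ i ⁆ j + x)) (sum-cong-≗ (𝟙-cong ∘ preimage)) ⟩
  ½ * (∑[ j < n ] 𝟙 ⁅ σ i ⁆ j + ∑[ j < n ] 𝟙 ⁅ τ ⁆ j)
    ≡⟨ cong₂ (λ x y → ½ * (x + y)) (∑-𝟙⁅⁆ (σ i)) (∑-𝟙⁅⁆ τ) ⟩
  ½ * (1ℚ + 1ℚ)
    ≡⟨⟩
  1ℚ
    ∎
  where
  open ≡-Reasoning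

  τ : Fin n
  τ = proj₁ (injective⇒surjective σ-injective i)

  στ≡i : σ τ ≡ i
  στ≡i = proj₂ (injective⇒surjective σ-injective i) refl

  preimage : ∀ j → i ∈ ⁅ σ j ⁆ ⇔ j ∈ ⁅ τ ⁆
  preimage j = mk⇔
    (λ i∈⁅σj⁆ → subst (_∈ ⁅ τ ⁆) (σ-injective (trans στ≡i (x∈⁅y⁆⇒x≡y (σ j) i∈⁅σj⁆))) (x∈⁅x⁆ τ))
    (λ j∈⁅τ⁆ → subst (_∈ ⁅ σ j ⁆) (trans (cong σ (x∈⁅y⁆⇒x≡y τ j∈⁅τ⁆)) στ≡i) (x∈⁅x⁆ (σ j)))

Edge : Graph n → Fin n → Fin n → Set
Edge H i j = adj H i j ≡ true

Er≡∑ : ∀ (w : Fin n → Fin n → ℚ) → Er w ≡ ∑[ i < n ] ℚ.∣ 1ℚ - degree w i ∣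
Er≡∑ {n} w = trans (Σ≡∑ n _) (sum-cong-≗ (λ i → cong (λ x → ℚ.∣ 1ℚ - x ∣) (Σ≡∑ n (w i))))

matching-weight-∈W : ∀ (H : Graph n) {σ} → (∀ i → Edge H i (σ i)) → InW H (matching-weight σ)
matching-weight-∈W H {σ} σ-edge =
  (λ i j → cong (½ *_) (+-comm (𝟙 ⁅ σ i ⁆ j) (𝟙 ⁅ σ j ⁆ i))) ,
  (λ i j → ½[χa+χb]∈[0,1] (does (j ∈? ⁅ σ i ⁆)) (does (i ∈? ⁅ σ j ⁆))) ,
  (λ i j non-edge → cong₂ (λ x y → ½ * (x + y))
     (𝟙-∉ (non-edge⇒∉⁅σ⁆ non-edge))
     (𝟙-∉ (non-edge⇒∉⁅σ⁆ (trans (adj-sym H j i) non-edge))))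
  where
  non-edge⇒∉⁅σ⁆ : ∀ {i j} → adj H i j ≡ false → j ∉ ⁅ σ i ⁆
  non-edge⇒∉⁅σ⁆ {i} non-edge j∈⁅σi⁆ with refl ← x∈⁅y⁆⇒x≡y (σ i) j∈⁅σi⁆ =
    contradiction (trans (sym (σ-edge i)) non-edge) λ ()

perfect-matching⇒solution : ∀ (H : Graph n) → Hall.Matching (Edge H) ⊤ ⊤ →
                            ∃ λ w → InW H w × Solves w
perfect-matching⇒solution {n} H M =
  matching-weight σ ,
  matching-weight-∈W H (λ i → match-edge ∈⊤) ,
  λ i → trans (Σ≡∑ n _) (degree-matching-weight (match-inj ∈⊤ ∈⊤) i)
  where
  open Hall.Matching M

  σ : Fin n → Fin n
  σ i = match (∈⊤ {x = i})

violator⇒1≤Er : ∀ (H : Graph n) → Hall.Violator (Edge H) ⊤ ⊤ →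
                ∀ {w} → InW H w → 1ℚ ≤ Er w
violator⇒1≤Er {n} H V {w} (w-sym , w-bounds , w-zero) = begin
  1ℚ                                ≤⟨ m<n⇒1≤fromℕn-fromℕm ∣T∣<∣S∣ ⟩
  fromℕ (∣ S ∣) - fromℕ (∣ T ∣)     ≤⟨ deficiency-bound w-sym w≥0 vanishes ⟩
  ∑[ i < n ] ℚ.∣ 1ℚ - degree w i ∣  ≡⟨ Er≡∑ w ⟨
  Er w                              ∎
  where
  open ≤-Reasoning
  open Hall.Violator V

  w≥0 : ∀ i j → 0ℚ ≤ w i j
  w≥0 i j = proj₁ (w-bounds i j)

  vanishes : ∀ {i j} → i ∈ S → j ∉ T → w i j ≡ 0ℚ
  vanishes {i} {j} i∈S j∉T with adj H i j in ij
  ... | true  = contradiction (Hall.Closed.N[S]⊆T closed i∈S ∈⊤ ij) j∉T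
  ... | false = w-zero i j ij

lemma3p3 : (m : ℕ) → 1 Data.Nat.≤ m →
    ∃ λ (c : ℚ) → (0ℚ < c) ×
      ((H : Graph m) →
        ¬ (∃ λ (w : Fin m → Fin m → ℚ) → InW H w × Solves w) →
        (w : Fin m → Fin m → ℚ) → InW H w → c ≤ Er w)
lemma3p3 m _ = 1ℚ , positive⁻¹ 1ℚ , λ H unsolvable w w∈W →
  [ (λ M → contradiction (perfect-matching⇒solution H M) unsolvable)
  , (λ V → violator⇒1≤Er H V w∈W)
  ]′ (Hall.hall (Edge H) (λ i j → adj H i j Bool.≟ true) ⊤ ⊤)
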